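{- Let $n \in \mathbb{N}$ and let $\mathcal{F} \subseteq \mathcal{P}([n])$ be a nontrivial, union closed family. Let $x \in [n]$. Then for every $A \in \mathcal{F}$ with $x \in A$ it holds $$\#\{F \in \mathcal{F} : x \in F\} \geq \frac{1}{2^{\#A-1}+1} \cdot \#\mathcal{F}.$$
   Context: $[n] = \{1,\dots,n\}$ and $\mathcal{P}([n])$ is its power set; $\#X$ denotes the cardinality of a set $X$. A family $\mathcal{F} \subseteq \mathcal{P}([n])$ is nontrivial if $\bigcup_{F \in \mathcal{F}} F = [n]$, and union closed if $A, B \in \mathcal{F}$ implies $A \cup B \in \mathcal{F}$. -}

module Defs where

open import Data.Nat using (ℕ)
open import Data.Fin using (Fin)
open import Data.Fin.Subset using (Subset; _∪_) renaming (_∈_ to _∈ₛ_)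
open import Data.Fin.Subset.Properties using (_∈?_)
open import Data.List using (List; length; filter)
open import Data.List.Membership.Propositional using (_∈_)
open import Data.List.Relation.Unary.Unique.Propositional using (Unique)
open import Data.Product using (∃; _×_)

-- A family of subsets of [n] = Fin n, represented as a duplicate-free list
-- of subsets (so its length is the cardinality of the family).
record Family (n : ℕ) : Set where
  field
    members : List (Subset n)
    unique  : Unique members

open Family public

card : ∀ {n} → Family n → ℕ
card 𝓕 = length (members 𝓕)

countContaining : ∀ {n} → Fin n → Family n → ℕ
countContaining x 𝓕 = length (filter (x ∈?_) (members 𝓕))

Nontrivial : ∀ {n} → Family n → Set
Nontrivial {n} 𝓕 = (y : Fin n) → ∃ λ F → F ∈ members 𝓕 × y ∈ₛ F

UnionClosed : ∀ {n} → Family n → Set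
UnionClosed 𝓕 = ∀ {A B} → A ∈ members 𝓕 → B ∈ members 𝓕 → (A ∪ B) ∈ members 𝓕

{-# OPTIONS --safe #-}
module Submission where

-- For F ∈ 𝓕 with x ∉ F, the pair (F ∪ A, F ∩ A) determines F. Its first
-- component lies in 𝓕 and contains x (union closure, x ∈ A); its second is a
-- subset of A ∖ {x}. Hence #{F : x ∉ F} ≤ 2^(#A-1) · #{F : x ∈ F}, and adding
-- #{F : x ∈ F} to both sides gives the claim.

open import Defs
open import Data.Fin using (Fin)
open import Data.Vec using ([]; _∷_; here)
open import Data.Fin.Subset
  using (Subset; ∣_∣; _∪_; _∩_; _-_; _⊆_; _∉_; inside; outside)
  renaming (_∈_ to _∈ₛ_)
open import Data.Fin.Subset.Properties
  using ( _∈?_; ⊆-antisym; drop-∷-⊆; p⊆p∪q; q⊆p∪q; x∈p∪q⁻; x∈p∩q⁺; x∈p∩q⁻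
        ; x∈p∧x≢y⇒x∈p-y; x∈p⇒∣p-x∣<∣p∣)
open import Data.List using (List; []; _∷_; [_]; map; _++_; filter; length; cartesianProduct)
open import Data.List.Properties using (length-++; length-map; length-removeAt′)
open import Data.List.Membership.Propositional using (_∈_)
open import Data.List.Membership.Propositional.Properties
  using (∈-map⁺; ∈-map⁻; ∈-++⁺ˡ; ∈-++⁺ʳ; ∈-filter⁺; ∈-filter⁻; ∈-cartesianProduct⁺)
open import Data.List.Relation.Binary.Subset.Propositional using () renaming (_⊆_ to _⊆ₗ_)
open import Data.List.Relation.Unary.All as All using ()
open import Data.List.Relation.Unary.Any using (here; there; index; _─_)
open import Data.List.Relation.Unary.AllPairs using (_∷_)
open import Data.List.Relation.Unary.Unique.Propositional using (Unique)
import Data.List.Relation.Unary.Unique.Propositional.Properties as Unique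
open import Data.Nat using (ℕ; suc; _≤_; _*_; _+_; _∸_; _^_; z≤n; s≤s)
open import Data.Nat.Properties
  using (+-comm; *-comm; +-identityʳ; +-suc; +-monoʳ-≤; *-monoʳ-≤; ^-monoʳ-≤; ∸-monoˡ-≤; module ≤-Reasoning)
open import Data.Product using (_×_; _,_; proj₁; proj₂)
open import Data.Sum using ([_,_]′)
open import Function using (id)
open import Level using (0ℓ)
open import Relation.Nullary using (yes; no; contradiction)
open import Relation.Unary using (Pred; Decidable)
open import Relation.Unary.Properties using (∁?)
open import Relation.Binary.PropositionalEquality
  using (_≡_; _≢_; refl; sym; trans; cong; cong₂; subst; ≢-sym; module ≡-Reasoning)

module _ {A : Set} where

  ∈-─⁺ : ∀ {a b : A} {ys} (a∈ys : a ∈ ys) → b ∈ ys → b ≢ a → b ∈ (ys ─ a∈ys)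
  ∈-─⁺ (here refl)  (here refl)  b≢a = contradiction refl b≢a
  ∈-─⁺ (here refl)  (there b∈ys) _   = b∈ys
  ∈-─⁺ (there a∈ys) (here b≡y)   _   = here b≡y
  ∈-─⁺ (there a∈ys) (there b∈ys) b≢a = there (∈-─⁺ a∈ys b∈ys b≢a)

  unique-⊆⇒length≤ : ∀ {xs ys : List A} → Unique xs → xs ⊆ₗ ys → length xs ≤ length ys
  unique-⊆⇒length≤ {[]}     _            _     = z≤n
  unique-⊆⇒length≤ {a ∷ xs} {ys} (a∉xs ∷ xs!) xs⊆ys = begin
    suc (length xs)          ≤⟨ s≤s (unique-⊆⇒length≤ xs! xs⊆ys─a) ⟩
    suc (length (ys ─ a∈ys)) ≡⟨ sym (length-removeAt′ ys (index a∈ys)) ⟩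
    length ys                ∎
    where
    open ≤-Reasoning
    a∈ys : a ∈ ys
    a∈ys = xs⊆ys (here refl)
    xs⊆ys─a : xs ⊆ₗ (ys ─ a∈ys)
    xs⊆ys─a b∈xs = ∈-─⁺ a∈ys (xs⊆ys (there b∈xs)) (≢-sym (All.lookup a∉xs b∈xs))

length-cartesianProduct : ∀ {A B : Set} (xs : List A) (ys : List B) →
                          length (cartesianProduct xs ys) ≡ length xs * length ys
length-cartesianProduct []       ys = refl
length-cartesianProduct (x ∷ xs) ys = trans (length-++ (map (x ,_) ys))
  (cong₂ _+_ (length-map (x ,_) ys) (length-cartesianProduct xs ys))

module _ {A : Set} {P : Pred A 0ℓ} (P? : Decidable P) where

  length-filter+filter-∁ : ∀ xs → length (filter P? xs) + length (filter (∁? P?) xs) ≡ length xs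
  length-filter+filter-∁ []       = refl
  length-filter+filter-∁ (x ∷ xs) with P? x
  ... | yes _ = cong suc (length-filter+filter-∁ xs)
  ... | no  _ = trans (+-suc _ _) (cong suc (length-filter+filter-∁ xs))

subsets : ∀ {n} → Subset n → List (Subset n)
subsets []            = [ [] ]
subsets (outside ∷ p) = map (outside ∷_) (subsets p)
subsets (inside  ∷ p) = map (outside ∷_) (subsets p) ++ map (inside ∷_) (subsets p)

length-subsets : ∀ {n} (p : Subset n) → length (subsets p) ≡ 2 ^ ∣ p ∣
length-subsets []            = refl
length-subsets (outside ∷ p) = trans (length-map _ (subsets p)) (length-subsets p)
length-subsets (inside  ∷ p) = begin
  length (map (outside ∷_) (subsets p) ++ map (inside ∷_) (subsets p))
    ≡⟨ length-++ (map (outside ∷_) (subsets p)) ⟩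
  length (map (outside ∷_) (subsets p)) + length (map (inside ∷_) (subsets p))
    ≡⟨ cong₂ _+_ (length-map _ (subsets p)) (length-map _ (subsets p)) ⟩
  length (subsets p) + length (subsets p)
    ≡⟨ cong₂ _+_ (length-subsets p) (trans (length-subsets p) (sym (+-identityʳ _))) ⟩
  2 ^ suc ∣ p ∣ ∎
  where open ≡-Reasoning

⊆⇒∈-subsets : ∀ {n} {p q : Subset n} → q ⊆ p → q ∈ subsets p
⊆⇒∈-subsets {p = []}          {[]}          _   = here refl
⊆⇒∈-subsets {p = outside ∷ p} {outside ∷ q} q⊆p = ∈-map⁺ _ (⊆⇒∈-subsets (drop-∷-⊆ q⊆p))
⊆⇒∈-subsets {p = outside ∷ p} {inside  ∷ q} q⊆p = contradiction (q⊆p here) λ ()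
⊆⇒∈-subsets {p = inside  ∷ p} {outside ∷ q} q⊆p =
  ∈-++⁺ˡ (∈-map⁺ _ (⊆⇒∈-subsets (drop-∷-⊆ q⊆p)))
⊆⇒∈-subsets {p = inside  ∷ p} {inside  ∷ q} q⊆p =
  ∈-++⁺ʳ (map (outside ∷_) (subsets p)) (∈-map⁺ _ (⊆⇒∈-subsets (drop-∷-⊆ q⊆p)))

∪-∩-cancelʳ-⊆ : ∀ {n} (r : Subset n) {p q} → p ∪ r ≡ q ∪ r → p ∩ r ≡ q ∩ r → p ⊆ q
∪-∩-cancelʳ-⊆ r {p} {q} p∪r≡q∪r p∩r≡q∩r {y} y∈p with y ∈? r
... | yes y∈r = proj₁ (x∈p∩q⁻ q r (subst (y ∈ₛ_) p∩r≡q∩r (x∈p∩q⁺ (y∈p , y∈r))))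
... | no  y∉r = [ id , (λ y∈r → contradiction y∈r y∉r) ]′
                  (x∈p∪q⁻ q r (subst (y ∈ₛ_) p∪r≡q∪r (p⊆p∪q r y∈p)))

∪-∩-cancelʳ : ∀ {n} (r : Subset n) {p q} → p ∪ r ≡ q ∪ r → p ∩ r ≡ q ∩ r → p ≡ q
∪-∩-cancelʳ r p∪r≡q∪r p∩r≡q∩r =
  ⊆-antisym (∪-∩-cancelʳ-⊆ r p∪r≡q∪r p∩r≡q∩r) (∪-∩-cancelʳ-⊆ r (sym p∪r≡q∪r) (sym p∩r≡q∩r))

x∉p⇒p∩q⊆q-x : ∀ {n} {x : Fin n} {p} (q : Subset n) → x ∉ p → p ∩ q ⊆ q - x
x∉p⇒p∩q⊆q-x {p = p} q x∉p y∈p∩q with x∈p∩q⁻ p q y∈p∩q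
... | y∈p , y∈q = x∈p∧x≢y⇒x∈p-y y∈q λ { refl → x∉p y∈p }

x∈p⇒∣p-x∣≤∣p∣∸1 : ∀ {n} {x : Fin n} {p} → x ∈ₛ p → ∣ p - x ∣ ≤ ∣ p ∣ ∸ 1
x∈p⇒∣p-x∣≤∣p∣∸1 x∈p = ∸-monoˡ-≤ 1 (x∈p⇒∣p-x∣<∣p∣ x∈p)

countAvoiding : ∀ {n} → Fin n → Family n → ℕ
countAvoiding x 𝓕 = length (filter (∁? (x ∈?_)) (members 𝓕))

card≡countContaining+countAvoiding : ∀ {n} (x : Fin n) (𝓕 : Family n) →
                                     card 𝓕 ≡ countContaining x 𝓕 + countAvoiding x 𝓕
card≡countContaining+countAvoiding x 𝓕 = sym (length-filter+filter-∁ (x ∈?_) (members 𝓕))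

countAvoiding≤countContaining*2^∣A-x∣ :
  ∀ {n} (𝓕 : Family n) {x A} → UnionClosed 𝓕 → A ∈ members 𝓕 → x ∈ₛ A →
  countAvoiding x 𝓕 ≤ countContaining x 𝓕 * 2 ^ ∣ A - x ∣
countAvoiding≤countContaining*2^∣A-x∣ {n} 𝓕 {x} {A} ∪-closed A∈𝓕 x∈A = begin
  countAvoiding x 𝓕                           ≡⟨ sym (length-map split avoiding) ⟩
  length (map split avoiding)                 ≤⟨ unique-⊆⇒length≤ split-unique split-⊆ ⟩
  length (cartesianProduct containing traces) ≡⟨ length-cartesianProduct containing traces ⟩
  countContaining x 𝓕 * length traces         ≡⟨ cong (countContaining x 𝓕 *_) (length-subsets (A - x)) ⟩
  countContaining x 𝓕 * 2 ^ ∣ A - x ∣         ∎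
  where
  open ≤-Reasoning
  containing avoiding traces : List (Subset n)
  containing = filter (x ∈?_) (members 𝓕)
  avoiding   = filter (∁? (x ∈?_)) (members 𝓕)
  traces     = subsets (A - x)

  split : Subset n → Subset n × Subset n
  split F = F ∪ A , F ∩ A

  split-unique : Unique (map split avoiding)
  split-unique = Unique.map⁺ (λ e → ∪-∩-cancelʳ A (cong proj₁ e) (cong proj₂ e)) (Unique.filter⁺ _ (unique 𝓕))

  split-⊆ : map split avoiding ⊆ₗ cartesianProduct containing traces
  split-⊆ q with ∈-map⁻ split q
  ... | F , F∈avoiding , refl with ∈-filter⁻ (∁? (x ∈?_)) F∈avoiding
  ... | F∈𝓕 , x∉F = ∈-cartesianProduct⁺
    (∈-filter⁺ (x ∈?_) (∪-closed F∈𝓕 A∈𝓕) (q⊆p∪q F A x∈A))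
    (⊆⇒∈-subsets (x∉p⇒p∩q⊆q-x A x∉F))

lemma2p4 : (n : ℕ) (𝓕 : Family n) → Nontrivial 𝓕 → UnionClosed 𝓕 →
    (x : Fin n) (A : Subset n) → A ∈ members 𝓕 → x ∈ₛ A →
    card 𝓕 ≤ (2 ^ (∣ A ∣ ∸ 1) + 1) * countContaining x 𝓕
lemma2p4 n 𝓕 _ ∪-closed x A A∈𝓕 x∈A = begin
  card 𝓕                         ≡⟨ card≡countContaining+countAvoiding x 𝓕 ⟩
  c + countAvoiding x 𝓕          ≤⟨ +-monoʳ-≤ c (countAvoiding≤countContaining*2^∣A-x∣ 𝓕 ∪-closed A∈𝓕 x∈A) ⟩
  c + c * 2 ^ ∣ A - x ∣           ≤⟨ +-monoʳ-≤ c (*-monoʳ-≤ c (^-monoʳ-≤ 2 (x∈p⇒∣p-x∣≤∣p∣∸1 x∈A))) ⟩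
  c + c * k                      ≡⟨ cong (c +_) (*-comm c k) ⟩
  suc k * c                      ≡⟨ cong (_* c) (+-comm 1 k) ⟩
  (k + 1) * c                    ∎
  where
  open ≤-Reasoning
  c = countContaining x 𝓕
  k = 2 ^ (∣ A ∣ ∸ 1)
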